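{- Let $T$ be a theory. If $T'\vdash_{\mathsf{CL}} A'$, then $T'\vdash_{\mathsf{CL}} A[x/t]'$ for every variable $x$ and term $t$.
   Context: Syntax of $\mathsf{SE}$: countably infinite sets of justification constants $\mathsf{JConst}=\{0,1,c_1,\dots\}$, variables $\mathsf{JVar}$; terms $\mathsf{Tm}$: constants, variables, $s\cdot t$, $s+t$; formulas $\mathsf{Fml}$: $\bot$, atoms $P\in\mathsf{Prop}$, $A\to B$, $t:A$. $A[w/t]$ replaces the variable $w$ by $t$; $A\sigma$ for $\sigma:\mathsf{JVar}\to\mathsf{Tm}$ replaces simultaneously each $x$ by $\sigma(x)$. Axioms of $\mathsf{SE}$ (for all formulas $A,B$, variables $w,x,y,z$): propositional tautologies; $x:(A\to B)\to(y:A\to x\cdot y:B)$; $x:A\wedge y:A\to(x+y):A$; $A[w/(x+y)+z]\to A[w/x+(y+z)]$; $A[w/x+y]\to A[w/y+x]$; $A[w/x+0]\leftrightarrow A[w/x]$; $A[w/(x\cdot y)\cdot z]\leftrightarrow A[w/x\cdot(y\cdot z)]$; $A[w/x\cdot 0]\leftrightarrow A[w/0]$; $A[w/0\cdot x]\leftrightarrow A[w/0]$; $A[w/x\cdot 1]\leftrightarrow A[w/x]$; $A[w/1\cdot x]\leftrightarrow A[w/x]$; $A[w/x\cdot(y+z)]\leftrightarrow A[w/x\cdot y+x\cdot z]$; $A[w/(y+z)\cdot x]\leftrightarrow A[w/y\cdot x+z\cdot x]$. A theory is a set of formulas. $[t]$ is the class of term $t$ modulo the semiring equalities ($+$ associative,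 commutative, neutral $0$; $\cdot$ associative, neutral $1$; distributivity; $0$ absorbing), $S_{\mathsf{Tm}}$ the set of such classes; $\mathsf{Fml}_{S_{\mathsf{Tm}}}$ the formulas with elements of $S_{\mathsf{Tm}}$ in place of terms, and $[\bot]=\bot$, $[P]=P$, $[A\to B]=[A]\to[B]$, $[t:A]=[t]:[A]$. Let $\mathsf{Prop}_2$ be an infinite set of new atomic propositions disjoint from $\mathsf{Prop}$ and $f:S_{\mathsf{Tm}}\times\mathsf{Fml}_{S_{\mathsf{Tm}}}\to\mathsf{Prop}_2$ a fixed bijection. The translation $'$ to propositional formulas over $\mathsf{Prop}\cup\mathsf{Prop}_2$: $\bot'=\bot$, $P'=P$, $(A\to B)'=A'\to B'$, $(t:A)'=f([t],[A])$. $T'=\{(A\sigma)'\mid A\in T \text{ or } A \text{ an axiom of } \mathsf{SE},\ \sigma:\mathsf{JVar}\to\mathsf{Tm}\}$. $T'\vdash_{\mathsf{CL}}B$ means $B$ is derivable in classical propositional logic from the set $T'$. -}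

module Defs where

open import Data.Nat using (ℕ; _≟_)
open import Data.Bool using (Bool; true; false; _∨_; not)
open import Data.Product using (Σ; _×_; _,_)
open import Data.Sum using (_⊎_)
open import Relation.Nullary using (yes; no)
open import Relation.Binary.PropositionalEquality using (_≡_)

Prop : Set
Prop = ℕ

JVar : Set
JVar = ℕ

data Tm : Set where
  𝟘 𝟙  : Tm
  con  : ℕ → Tm
  var  : JVar → Tm
  _·_  : Tm → Tm → Tm
  _⊕_  : Tm → Tm → Tm

infixl 7 _·_
infixl 6 _⊕_

data Fml : Set where
  ⊥f   : Fml
  atom : Prop → Fml
  _⇒_  : Fml → Fml → Fml
  _∶_  : Tm → Fml → Fml

infixr 4 _⇒_
infix 5 _∶_

substTm : (JVar → Tm) → Tm → Tm
substTm σ 𝟘 = 𝟘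
substTm σ 𝟙 = 𝟙
substTm σ (con i) = con i
substTm σ (var x) = σ x
substTm σ (s · t) = substTm σ s · substTm σ t
substTm σ (s ⊕ t) = substTm σ s ⊕ substTm σ t

_⟪_⟫ : Fml → (JVar → Tm) → Fml
⊥f ⟪ σ ⟫ = ⊥f
atom P ⟪ σ ⟫ = atom P
(A ⇒ B) ⟪ σ ⟫ = (A ⟪ σ ⟫) ⇒ (B ⟪ σ ⟫)
(t ∶ A) ⟪ σ ⟫ = substTm σ t ∶ (A ⟪ σ ⟫)

single : JVar → Tm → JVar → Tm
single w t y with y ≟ w
... | yes _ = t
... | no _ = var y

_[_/_] : Fml → JVar → Tm → Fml
A [ w / t ] = A ⟪ single w t ⟫

-- Propositional tautologies of the SE language
-- (formulas P and t:B are treated as propositional atoms)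

_⇒b_ : Bool → Bool → Bool
a ⇒b b = not a ∨ b

eval : (Prop → Bool) → (Tm → Fml → Bool) → Fml → Bool
eval v w ⊥f = false
eval v w (atom P) = v P
eval v w (A ⇒ B) = eval v w A ⇒b eval v w B
eval v w (t ∶ A) = w t A

Tautology : Fml → Set
Tautology A = ∀ v w → eval v w A ≡ true

_∧f_ : Fml → Fml → Fml
A ∧f B = (A ⇒ (B ⇒ ⊥f)) ⇒ ⊥f

_⇔f_ : Fml → Fml → Fml
A ⇔f B = (A ⇒ B) ∧f (B ⇒ A)

data Axiom : Fml → Set where
  taut     : ∀ {A} → Tautology A → Axiom A
  app      : ∀ A B x y →
             Axiom ((var x ∶ (A ⇒ B)) ⇒ ((var y ∶ A) ⇒ (var x · var y ∶ B)))
  sum      : ∀ A x y →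
             Axiom (((var x ∶ A) ∧f (var y ∶ A)) ⇒ (var x ⊕ var y ∶ A))
  +assoc   : ∀ A w x y z →
             Axiom ((A [ w / (var x ⊕ var y) ⊕ var z ]) ⇒ (A [ w / var x ⊕ (var y ⊕ var z) ]))
  +comm    : ∀ A w x y →
             Axiom ((A [ w / var x ⊕ var y ]) ⇒ (A [ w / var y ⊕ var x ]))
  +zero    : ∀ A w x →
             Axiom ((A [ w / var x ⊕ 𝟘 ]) ⇔f (A [ w / var x ]))
  ·assoc   : ∀ A w x y z →
             Axiom ((A [ w / (var x · var y) · var z ]) ⇔f (A [ w / var x · (var y · var z) ]))
  ·zeroʳ   : ∀ A w x →
             Axiom ((A [ w / var x · 𝟘 ]) ⇔f (A [ w / 𝟘 ]))
  ·zeroˡ   : ∀ A w x →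
             Axiom ((A [ w / 𝟘 · var x ]) ⇔f (A [ w / 𝟘 ]))
  ·oneʳ    : ∀ A w x →
             Axiom ((A [ w / var x · 𝟙 ]) ⇔f (A [ w / var x ]))
  ·oneˡ    : ∀ A w x →
             Axiom ((A [ w / 𝟙 · var x ]) ⇔f (A [ w / var x ]))
  distribˡ : ∀ A w x y z →
             Axiom ((A [ w / var x · (var y ⊕ var z) ]) ⇔f (A [ w / var x · var y ⊕ var x · var z ]))
  distribʳ : ∀ A w x y z →
             Axiom ((A [ w / (var y ⊕ var z) · var x ]) ⇔f (A [ w / var y · var x ⊕ var z · var x ]))

infix 4 _≈_ _≈F_ _~_

data _≈_ : Tm → Tm → Set where
  ≈refl   : ∀ {s} → s ≈ s
  ≈sym    : ∀ {s t} → s ≈ t → t ≈ s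
  ≈trans  : ∀ {s t u} → s ≈ t → t ≈ u → s ≈ u
  ·cong   : ∀ {s s' t t'} → s ≈ s' → t ≈ t' → s · t ≈ s' · t'
  ⊕cong   : ∀ {s s' t t'} → s ≈ s' → t ≈ t' → s ⊕ t ≈ s' ⊕ t'
  ⊕assoc  : ∀ s t u → (s ⊕ t) ⊕ u ≈ s ⊕ (t ⊕ u)
  ⊕comm   : ∀ s t → s ⊕ t ≈ t ⊕ s
  ⊕idʳ    : ∀ s → s ⊕ 𝟘 ≈ s
  ·assoc  : ∀ s t u → (s · t) · u ≈ s · (t · u)
  ·idʳ    : ∀ s → s · 𝟙 ≈ s
  ·idˡ    : ∀ s → 𝟙 · s ≈ s
  ·zeroʳ  : ∀ s → s · 𝟘 ≈ 𝟘
  ·zeroˡ  : ∀ s → 𝟘 · s ≈ 𝟘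
  distˡ   : ∀ s t u → s · (t ⊕ u) ≈ s · t ⊕ s · u
  distʳ   : ∀ s t u → (t ⊕ u) · s ≈ t · s ⊕ u · s

data _≈F_ : Fml → Fml → Set where
  ⊥≈   : ⊥f ≈F ⊥f
  atom≈ : ∀ P → atom P ≈F atom P
  ⇒≈   : ∀ {A A' B B'} → A ≈F A' → B ≈F B' → (A ⇒ B) ≈F (A' ⇒ B')
  ∶≈   : ∀ {s t A B} → s ≈ t → A ≈F B → (s ∶ A) ≈F (t ∶ B)

-- Propositional formulas over Prop ∪ Prop₂.
-- An atom of Prop₂ is f([t],[A]); it is represented by a pair (t, A),
-- two representatives denoting the same atom iff [t]=[s] and [A]=[B].

data PFml : Set where
  ⊥p   : PFml
  patom : Prop → PFml
  jatom : Tm → Fml → PFml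
  _⇒p_ : PFml → PFml → PFml

infixr 4 _⇒p_

data _~_ : PFml → PFml → Set where
  ⊥~    : ⊥p ~ ⊥p
  patom~ : ∀ P → patom P ~ patom P
  jatom~ : ∀ {s t A B} → s ≈ t → A ≈F B → jatom s A ~ jatom t B
  ⇒~    : ∀ {A A' B B'} → A ~ A' → B ~ B' → (A ⇒p B) ~ (A' ⇒p B')

_′ : Fml → PFml
⊥f ′ = ⊥p
atom P ′ = patom P
(A ⇒ B) ′ = (A ′) ⇒p (B ′)
(t ∶ A) ′ = jatom t A

Theory : Set₁
Theory = Fml → Set

_′T : Theory → PFml → Set
(T ′T) B = Σ Fml λ A → Σ (JVar → Tm) λ σ → (T A ⊎ Axiom A) × (B ≡ (A ⟪ σ ⟫) ′)

-- Classical propositional derivability (Hilbert calculus for ⊥,→),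
-- working with formulas over Prop ∪ Prop₂ (rule `conv` identifies
-- representatives of the same propositional formula).

infix 2 _⊢CL_

data _⊢CL_ (Γ : PFml → Set) : PFml → Set where
  hyp  : ∀ {B} → Γ B → Γ ⊢CL B
  axK  : ∀ A B → Γ ⊢CL A ⇒p (B ⇒p A)
  axS  : ∀ A B C → Γ ⊢CL (A ⇒p (B ⇒p C)) ⇒p ((A ⇒p B) ⇒p (A ⇒p C))
  axDN : ∀ A → Γ ⊢CL ((A ⇒p ⊥p) ⇒p ⊥p) ⇒p A
  mp   : ∀ {A B} → Γ ⊢CL A ⇒p B → Γ ⊢CL A → Γ ⊢CL B
  conv : ∀ {A B} → A ~ B → Γ ⊢CL A → Γ ⊢CL B

-- T′ is closed under substituting terms for justification variables, because
-- σ followed by τ is again a substitution; the Hilbert axioms, modus ponens and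
-- the identification of semiring-equal representatives are all stable under
-- substitution. So substituting in a derivation gives a derivation, and the
-- translation ′ commutes with substitution.
{-# OPTIONS --safe #-}
module Submission where

open import Defs
open import Data.Product using (_,_)
open import Relation.Binary.PropositionalEquality using (_≡_; refl; cong; cong₂; subst; trans)

_⟪_⟫ₚ : PFml → (JVar → Tm) → PFml
⊥p ⟪ σ ⟫ₚ = ⊥p
patom P ⟪ σ ⟫ₚ = patom P
jatom t A ⟪ σ ⟫ₚ = jatom (substTm σ t) (A ⟪ σ ⟫)
(A ⇒p B) ⟪ σ ⟫ₚ = (A ⟪ σ ⟫ₚ) ⇒p (B ⟪ σ ⟫ₚ)

′-⟪⟫ : ∀ σ A → (A ′) ⟪ σ ⟫ₚ ≡ (A ⟪ σ ⟫) ′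
′-⟪⟫ σ ⊥f = refl
′-⟪⟫ σ (atom P) = refl
′-⟪⟫ σ (A ⇒ B) = cong₂ _⇒p_ (′-⟪⟫ σ A) (′-⟪⟫ σ B)
′-⟪⟫ σ (t ∶ A) = refl

_∘ₛ_ : (JVar → Tm) → (JVar → Tm) → JVar → Tm
(τ ∘ₛ σ) y = substTm τ (σ y)

substTm-∘ : ∀ σ τ t → substTm τ (substTm σ t) ≡ substTm (τ ∘ₛ σ) t
substTm-∘ σ τ 𝟘 = refl
substTm-∘ σ τ 𝟙 = refl
substTm-∘ σ τ (con i) = refl
substTm-∘ σ τ (var x) = refl
substTm-∘ σ τ (s · t) = cong₂ _·_ (substTm-∘ σ τ s) (substTm-∘ σ τ t)
substTm-∘ σ τ (s ⊕ t) = cong₂ _⊕_ (substTm-∘ σ τ s) (substTm-∘ σ τ t)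

⟪⟫-∘ : ∀ σ τ A → (A ⟪ σ ⟫) ⟪ τ ⟫ ≡ A ⟪ τ ∘ₛ σ ⟫
⟪⟫-∘ σ τ ⊥f = refl
⟪⟫-∘ σ τ (atom P) = refl
⟪⟫-∘ σ τ (A ⇒ B) = cong₂ _⇒_ (⟪⟫-∘ σ τ A) (⟪⟫-∘ σ τ B)
⟪⟫-∘ σ τ (t ∶ A) = cong₂ _∶_ (substTm-∘ σ τ t) (⟪⟫-∘ σ τ A)

≈-substTm : ∀ σ {s t} → s ≈ t → substTm σ s ≈ substTm σ t
≈-substTm σ ≈refl = ≈refl
≈-substTm σ (≈sym p) = ≈sym (≈-substTm σ p)
≈-substTm σ (≈trans p q) = ≈trans (≈-substTm σ p) (≈-substTm σ q)
≈-substTm σ (·cong p q) = ·cong (≈-substTm σ p) (≈-substTm σ q)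
≈-substTm σ (⊕cong p q) = ⊕cong (≈-substTm σ p) (≈-substTm σ q)
≈-substTm σ (⊕assoc s t u) = ⊕assoc _ _ _
≈-substTm σ (⊕comm s t) = ⊕comm _ _
≈-substTm σ (⊕idʳ s) = ⊕idʳ _
≈-substTm σ (·assoc s t u) = ·assoc _ _ _
≈-substTm σ (·idʳ s) = ·idʳ _
≈-substTm σ (·idˡ s) = ·idˡ _
≈-substTm σ (·zeroʳ s) = ·zeroʳ _
≈-substTm σ (·zeroˡ s) = ·zeroˡ _
≈-substTm σ (distˡ s t u) = distˡ _ _ _
≈-substTm σ (distʳ s t u) = distʳ _ _ _

≈F-⟪⟫ : ∀ σ {A B} → A ≈F B → A ⟪ σ ⟫ ≈F B ⟪ σ ⟫
≈F-⟪⟫ σ ⊥≈ = ⊥≈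
≈F-⟪⟫ σ (atom≈ P) = atom≈ P
≈F-⟪⟫ σ (⇒≈ p q) = ⇒≈ (≈F-⟪⟫ σ p) (≈F-⟪⟫ σ q)
≈F-⟪⟫ σ (∶≈ p q) = ∶≈ (≈-substTm σ p) (≈F-⟪⟫ σ q)

~-⟪⟫ₚ : ∀ σ {A B} → A ~ B → A ⟪ σ ⟫ₚ ~ B ⟪ σ ⟫ₚ
~-⟪⟫ₚ σ ⊥~ = ⊥~
~-⟪⟫ₚ σ (patom~ P) = patom~ P
~-⟪⟫ₚ σ (jatom~ p q) = jatom~ (≈-substTm σ p) (≈F-⟪⟫ σ q)
~-⟪⟫ₚ σ (⇒~ p q) = ⇒~ (~-⟪⟫ₚ σ p) (~-⟪⟫ₚ σ q)

⊢CL-⟪⟫ₚ : ∀ {Γ : PFml → Set} τ → (∀ {B} → Γ B → Γ (B ⟪ τ ⟫ₚ)) →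
          ∀ {B} → Γ ⊢CL B → Γ ⊢CL B ⟪ τ ⟫ₚ
⊢CL-⟪⟫ₚ τ Γ-closed (hyp h) = hyp (Γ-closed h)
⊢CL-⟪⟫ₚ τ Γ-closed (axK A B) = axK _ _
⊢CL-⟪⟫ₚ τ Γ-closed (axS A B C) = axS _ _ _
⊢CL-⟪⟫ₚ τ Γ-closed (axDN A) = axDN _
⊢CL-⟪⟫ₚ τ Γ-closed (mp d e) = mp (⊢CL-⟪⟫ₚ τ Γ-closed d) (⊢CL-⟪⟫ₚ τ Γ-closed e)
⊢CL-⟪⟫ₚ τ Γ-closed (conv p d) = conv (~-⟪⟫ₚ τ p) (⊢CL-⟪⟫ₚ τ Γ-closed d)

′T-⟪⟫ₚ : ∀ T τ {B} → (T ′T) B → (T ′T) (B ⟪ τ ⟫ₚ)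
′T-⟪⟫ₚ T τ (A , σ , h , refl) =
  A , τ ∘ₛ σ , h , trans (′-⟪⟫ τ (A ⟪ σ ⟫)) (cong _′ (⟪⟫-∘ σ τ A))

mainTheorem13 : (T : Theory) (A : Fml) (x : JVar) (t : Tm) →
                (T ′T) ⊢CL (A ′) → (T ′T) ⊢CL ((A [ x / t ]) ′)
mainTheorem13 T A x t d =
  subst (T ′T ⊢CL_) (′-⟪⟫ (single x t) A)
        (⊢CL-⟪⟫ₚ (single x t) (′T-⟪⟫ₚ T (single x t)) d)
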